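{- Let $G$ be a robust sublinear expander with $n$ vertices, let $0\le\varepsilon\le1$ and let $U\subseteq V(G)$ be a vertex subset with $|U|\le n^{1-\varepsilon}$. Consider a (not necessarily proper) colouring of the edges of $G$ between $U$ and $V(G)\setminus U$ with the colours red and blue. Then at least one of the following holds: (1) there is a set $F_{\mathrm{red}}\subseteq E(G)$ of red edges with $|F_{\mathrm{red}}|\ge(\varepsilon/7)\cdot d(G)\cdot|U|$ and $\deg_{F_{\mathrm{red}}}(v)\le\lceil d(G)\rceil$ for all $v\in U$; or (2) there is a set $F_{\mathrm{blue}}\subseteq E(G)$ of blue edges with $|F_{\mathrm{blue}}|\ge(\varepsilon/7)\cdot d(G)\cdot|U|$ and $\deg_{F_{\mathrm{blue}}}(v')\le\lceil d(G)\rceil$ for all $v'\in V(G)\setminus U$.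
   Context: $d(G)=2|E(G)|/|V(G)|$ is the average degree. For $F\subseteq E(G)$ and a vertex $v$, $\deg_F(v)$ is the number of edges of $F$ incident to $v$. For $U\subseteq V(G)$ and $F\subseteq E(G)$, $N_{G-F}(U)$ is the set of vertices in $V(G)\setminus U$ adjacent to some vertex of $U$ in $G$ with the edges of $F$ deleted. A graph $G$ on $n\ge1$ vertices is a robust sublinear expander if for every $0\le\varepsilon\le1$, every non-empty $U\subseteq V(G)$ with $|U|\le n^{1-\varepsilon}$ and every $F\subseteq E(G)$ with $|F|\le(\varepsilon/3)\cdot d(G)\cdot|U|$, we have $|N_{G-F}(U)|\ge(\varepsilon/3)\cdot|U|$.
   Formalization: The parameter ε of the lemma takes only rational values with $0\le\varepsilon\le1$. -}

module Defs where

open import Data.Bool using (Bool; true; false; _∧_; _∨_; not; if_then_else_)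
open import Data.Nat as ℕ using (ℕ; zero; suc; _<ᵇ_; _^_; _∸_; NonZero)
open import Data.Fin using (Fin; toℕ)
open import Data.Fin.Subset using (Subset; _∈_; _∉_; ∣_∣)
open import Data.Vec using (lookup)
open import Data.Integer as ℤ using (ℤ; +_)
open import Data.Rational using (ℚ; ↥_; ↧ₙ_; _/_; _*_; _≤_; 0ℚ; 1ℚ)
open import Data.Product using (_×_)
open import Relation.Binary.PropositionalEquality using (_≡_)

record Graph (n : ℕ) : Set where
  field
    adj    : Fin n → Fin n → Bool
    sym    : ∀ u v → adj u v ≡ adj v u
    irrefl : ∀ v → adj v v ≡ false
open Graph public

count : ∀ {n} → (Fin n → Bool) → ℕ
count {zero}  p = 0
count {suc n} p = (if p Fin.zero then 1 else 0) ℕ.+ count {n} (λ i → p (Fin.suc i))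
  where import Data.Fin as Fin

sumFin : ∀ {n} → (Fin n → ℕ) → ℕ
sumFin {zero}  f = 0
sumFin {suc n} f = f Fin.zero ℕ.+ sumFin {n} (λ i → f (Fin.suc i))
  where import Data.Fin as Fin

anyFin : ∀ {n} → (Fin n → Bool) → Bool
anyFin {zero}  p = false
anyFin {suc n} p = p Fin.zero ∨ anyFin {n} (λ i → p (Fin.suc i))
  where import Data.Fin as Fin

-- A set of edges: a symmetric Boolean relation on vertices
-- (the unordered edge {u,v} belongs to F iff F u v = true).
EdgeSet : ℕ → Set
EdgeSet n = Fin n → Fin n → Bool

IsEdgeSetOf : ∀ {n} → Graph n → EdgeSet n → Set
IsEdgeSetOf G F = (∀ u v → F u v ≡ F v u) × (∀ u v → F u v ≡ true → adj G u v ≡ true)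

-- |F| : number of unordered pairs {u,v} (counted once, via toℕ u < toℕ v) in F
∣_∣ₑ : ∀ {n} → EdgeSet n → ℕ
∣ F ∣ₑ = sumFin (λ u → count (λ v → (toℕ u <ᵇ toℕ v) ∧ F u v))

degIn : ∀ {n} → EdgeSet n → Fin n → ℕ
degIn F v = count (λ w → F v w)

numEdges : ∀ {n} → Graph n → ℕ
numEdges G = ∣ adj G ∣ₑ

ℕ→ℚ : ℕ → ℚ
ℕ→ℚ k = (+ k) / 1

avgDeg : ∀ {n} .{{_ : NonZero n}} → Graph n → ℚ
avgDeg {n} G = (+ (2 ℕ.* numEdges G)) / n

_÷ₙ_ : ℚ → (k : ℕ) → .{{_ : NonZero k}} → ℚ
ε ÷ₙ k = ε * ((+ 1) / k)

-- |U| ≤ n^(1-ε) for rational 0 ≤ ε ≤ 1 with ε = p/q in lowest terms (p ≥ 0):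
-- equivalent (both sides nonnegative) to |U|^q ≤ n^(q-p).
SizeBound : ℕ → ℕ → ℚ → Set
SizeBound u n ε = u ^ (↧ₙ ε) ℕ.≤ n ^ (↧ₙ ε ∸ ℤ.∣ ↥ ε ∣)

∣N∣ : ∀ {n} → Graph n → EdgeSet n → Subset n → ℕ
∣N∣ G F U = count (λ v → not (lookup U v) ∧
                      anyFin (λ u → lookup U u ∧ adj G u v ∧ not (F u v)))

RobustSublinearExpander : ∀ {n} .{{_ : NonZero n}} → Graph n → Set
RobustSublinearExpander {n} G =
  ∀ (ε : ℚ) → 0ℚ ≤ ε → ε ≤ 1ℚ →
  ∀ (U : Subset n) → 0 ℕ.< ∣ U ∣ → SizeBound ∣ U ∣ n ε →
  ∀ (F : EdgeSet n) → IsEdgeSetOf G F →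
  ℕ→ℚ ∣ F ∣ₑ ≤ (ε ÷ₙ 3) * avgDeg G * ℕ→ℚ ∣ U ∣ →
  (ε ÷ₙ 3) * ℕ→ℚ ∣ U ∣ ≤ ℕ→ℚ (∣N∣ G F U)

-- a red/blue colouring of the edges between U and V∖U:
-- col u v (for u ∈ U, v ∉ U, uv ∈ E(G)) is the colour of the edge uv; true = red.
Colouring : ℕ → Set
Colouring n = Fin n → Fin n → Bool

red blue : Bool
red = true
blue = false

MonochromaticCrossing : ∀ {n} → Graph n → Subset n → Colouring n → Bool → EdgeSet n → Set
MonochromaticCrossing G U col c F =
  IsEdgeSetOf G F ×
  (∀ u v → F u v ≡ true → u ∈ U → v ∉ U × col u v ≡ c) ×
  (∀ u v → F u v ≡ true → u ∉ U → v ∈ U)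

-- Let D = ⌈d(G)⌉. Greedily, every u ∈ U keeps at most D of its red edges to V∖U and
-- every v ∉ U keeps at most D of its blue edges to U; a vertex is full if it keeps
-- exactly D edges. The kept red edges F_red and kept blue edges F_blue satisfy the
-- degree bounds, and each full vertex contributes D ≥ d(G) kept edges, so if neither
-- kept set is large, fewer than (ε/7)|U| vertices inside U and fewer than (ε/7)|U|
-- outside U are full. Let U' be U minus its full vertices and F = F_red ∪ F_blue.
-- An edge of G − F leaving U' ends at a full vertex (otherwise it would have been
-- kept), so |N_{G−F}(U')| < (2ε/7)|U|. Since |U'| ≥ (6/7)|U| and
-- |F| < (2ε/7)d(G)|U| ≤ (ε/3)d(G)|U'|, this contradicts robust expansion of U'.
module Submission where

open import Defs hiding (sym)
open import Data.Nat using (ℕ; NonZero)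
open import Data.Fin using (Fin)
open import Data.Fin.Subset using (Subset; _∈_; _∉_; ∣_∣)

module Counting where
  open import Data.Bool using (Bool; true; false; _∧_; _∨_; not; if_then_else_; T)
  open import Data.Bool.Properties using (∧-conicalˡ; ∧-conicalʳ; ∧-identityʳ; ∧-zeroʳ)
  open import Data.Nat using (ℕ; zero; suc; _+_; _*_; _≤_; _<_; _<ᵇ_; _≤ᵇ_; z≤n; s≤s)
  open import Data.Nat.Properties
  open import Data.Fin using (Fin; zero; suc; toℕ)
  open import Data.Fin.Properties using (toℕ-injective)
  open import Data.Vec using ([]; _∷_; lookup)
  open import Data.Vec.Properties using ([]=⇒lookup; lookup⇒[]=)
  open import Data.Product using (Σ; _×_; _,_)
  open import Data.Sum using (_⊎_; inj₁; inj₂; [_,_]′)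
  open import Data.Empty using (⊥; ⊥-elim)
  open import Function using (_∘_)
  open import Relation.Binary.PropositionalEquality
  open import Algebra.Properties.CommutativeMonoid.Sum +-0-commutativeMonoid
    using (sum; sum-syntax; ∑-comm; ∑-distrib-+; sum-cong-≗)

  ind : Bool → ℕ
  ind b = if b then 1 else 0

  ∧-true : ∀ {a b} → a ∧ b ≡ true → a ≡ true × b ≡ true
  ∧-true {a} {b} e = ∧-conicalˡ a b e , ∧-conicalʳ a b e

  ∨-true : ∀ {a b} → a ∨ b ≡ true → a ≡ true ⊎ b ≡ true
  ∨-true {true}  _ = inj₁ refl
  ∨-true {false} e = inj₂ e

  ∧-intro : ∀ {a b} → a ≡ true → b ≡ true → a ∧ b ≡ true
  ∧-intro refl refl = refl

  ∨-introˡ : ∀ {a b} → a ≡ true → a ∨ b ≡ true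
  ∨-introˡ refl = refl

  ∨-introʳ : ∀ {a b} → b ≡ true → a ∨ b ≡ true
  ∨-introʳ {true}  _ = refl
  ∨-introʳ {false} e = e

  not-true : ∀ {a} → not a ≡ true → a ≡ false
  not-true {false} _ = refl

  true-or-false : ∀ b → b ≡ true ⊎ b ≡ false
  true-or-false true  = inj₁ refl
  true-or-false false = inj₂ refl

  true≢false : ∀ {a} → a ≡ true → a ≡ false → ⊥
  true≢false refl ()

  ≤ᵇ≡false⇒> : ∀ {m n} → (m ≤ᵇ n) ≡ false → n < m
  ≤ᵇ≡false⇒> {m} {n} e = ≰⇒> λ m≤n → subst T e (≤⇒≤ᵇ m≤n)

  ≤ᵇ≡true⇒≤ : ∀ {m n} → (m ≤ᵇ n) ≡ true → m ≤ n
  ≤ᵇ≡true⇒≤ {m} {n} e = ≤ᵇ⇒≤ m n (subst T (sym e) _)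

  sumFin≡∑ : ∀ {n} (f : Fin n → ℕ) → sumFin f ≡ ∑[ i < n ] f i
  sumFin≡∑ {zero}  f = refl
  sumFin≡∑ {suc n} f = cong (f zero +_) (sumFin≡∑ (f ∘ suc))

  sumFin-cong : ∀ {n} {f g : Fin n → ℕ} → (∀ i → f i ≡ g i) → sumFin f ≡ sumFin g
  sumFin-cong {f = f} {g} f≗g = trans (sumFin≡∑ f) (trans (sum-cong-≗ f≗g) (sym (sumFin≡∑ g)))

  sumFin-mono : ∀ {n} {f g : Fin n → ℕ} → (∀ i → f i ≤ g i) → sumFin f ≤ sumFin g
  sumFin-mono {zero}  f≤g = z≤n
  sumFin-mono {suc n} f≤g = +-mono-≤ (f≤g zero) (sumFin-mono (f≤g ∘ suc))

  sumFin-+ : ∀ {n} (f g : Fin n → ℕ) → sumFin (λ i → f i + g i) ≡ sumFin f + sumFin g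
  sumFin-+ f g = begin
    sumFin (λ i → f i + g i)  ≡⟨ sumFin≡∑ (λ i → f i + g i) ⟩
    ∑[ i < _ ] (f i + g i)    ≡⟨ ∑-distrib-+ f g ⟩
    sum f + sum g             ≡⟨ sym (cong₂ _+_ (sumFin≡∑ f) (sumFin≡∑ g)) ⟩
    sumFin f + sumFin g       ∎
    where open ≡-Reasoning

  sumFin-comm : ∀ {m n} (f : Fin m → Fin n → ℕ) →
                sumFin (λ i → sumFin (f i)) ≡ sumFin (λ j → sumFin (λ i → f i j))
  sumFin-comm {m} {n} f = begin
    sumFin (λ i → sumFin (f i))             ≡⟨ sumFin-cong (λ i → sumFin≡∑ (f i)) ⟩
    sumFin (λ i → ∑[ j < n ] f i j)         ≡⟨ sumFin≡∑ (λ i → ∑[ j < n ] f i j) ⟩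
    ∑[ i < m ] ∑[ j < n ] f i j             ≡⟨ ∑-comm f ⟩
    ∑[ j < n ] ∑[ i < m ] f i j             ≡⟨ sumFin≡∑ (λ j → ∑[ i < m ] f i j) ⟨
    sumFin (λ j → ∑[ i < m ] f i j)         ≡⟨ sumFin-cong (λ j → sumFin≡∑ (λ i → f i j)) ⟨
    sumFin (λ j → sumFin (λ i → f i j))     ∎
    where open ≡-Reasoning

  count≡sumFin-ind : ∀ {n} (p : Fin n → Bool) → count p ≡ sumFin (ind ∘ p)
  count≡sumFin-ind {zero}  p = refl
  count≡sumFin-ind {suc n} p = cong (ind (p zero) +_) (count≡sumFin-ind (p ∘ suc))

  count-+ : ∀ {n} (p q r : Fin n → Bool) → (∀ i → ind (p i) + ind (q i) ≡ ind (r i)) →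
            count p + count q ≡ count r
  count-+ p q r pointwise = begin
    count p + count q                            ≡⟨ cong₂ _+_ (count≡sumFin-ind p) (count≡sumFin-ind q) ⟩
    sumFin (ind ∘ p) + sumFin (ind ∘ q)          ≡⟨ sumFin-+ (ind ∘ p) (ind ∘ q) ⟨
    sumFin (λ i → ind (p i) + ind (q i))         ≡⟨ sumFin-cong pointwise ⟩
    sumFin (ind ∘ r)                             ≡⟨ count≡sumFin-ind r ⟨
    count r                                      ∎
    where open ≡-Reasoning

  count-≤-+ : ∀ {n} (p q r : Fin n → Bool) → (∀ i → r i ≡ true → p i ≡ true ⊎ q i ≡ true) →
              count r ≤ count p + count q
  count-≤-+ p q r r⊆p∪q = begin
    count r                                ≡⟨ count≡sumFin-ind r ⟩
    sumFin (ind ∘ r)                       ≤⟨ sumFin-mono (λ i → ind-∪ (r⊆p∪q i)) ⟩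
    sumFin (λ i → ind (p i) + ind (q i))   ≡⟨ sumFin-+ (ind ∘ p) (ind ∘ q) ⟩
    sumFin (ind ∘ p) + sumFin (ind ∘ q)    ≡⟨ cong₂ _+_ (count≡sumFin-ind p) (count≡sumFin-ind q) ⟨
    count p + count q                      ∎
    where
    open ≤-Reasoning
    ind-∪ : ∀ {a b c} → (c ≡ true → a ≡ true ⊎ b ≡ true) → ind c ≤ ind a + ind b
    ind-∪ {c = false} _ = z≤n
    ind-∪ {a} {b} {true} c⊆a∪b with c⊆a∪b refl
    ... | inj₁ refl = s≤s z≤n
    ... | inj₂ refl = m≤n+m 1 (ind a)

  count-mono : ∀ {n} {p q : Fin n → Bool} → (∀ i → p i ≡ true → q i ≡ true) → count p ≤ count q
  count-mono {p = p} {q} p⊆q = begin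
    count p           ≡⟨ count≡sumFin-ind p ⟩
    sumFin (ind ∘ p)  ≤⟨ sumFin-mono (λ i → ind-mono (p⊆q i)) ⟩
    sumFin (ind ∘ q)  ≡⟨ count≡sumFin-ind q ⟨
    count q           ∎
    where
    open ≤-Reasoning
    ind-mono : ∀ {a b} → (a ≡ true → b ≡ true) → ind a ≤ ind b
    ind-mono {false} _   = z≤n
    ind-mono {true}  a⇒b rewrite a⇒b refl = ≤-refl

  count*≤sumFin : ∀ {n} (p : Fin n → Bool) (f : Fin n → ℕ) {D} →
                  (∀ i → p i ≡ true → D ≤ f i) → count p * D ≤ sumFin f
  count*≤sumFin {zero}  p f big = z≤n
  count*≤sumFin {suc n} p f {D} big = begin
    count p * D
      ≡⟨ *-distribʳ-+ D (ind (p zero)) (count (p ∘ suc)) ⟩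
    ind (p zero) * D + count (p ∘ suc) * D
      ≤⟨ +-mono-≤ (ind*≤ (big zero)) (count*≤sumFin (p ∘ suc) (f ∘ suc) (big ∘ suc)) ⟩
    f zero + sumFin (f ∘ suc)
      ∎
    where
    open ≤-Reasoning
    ind*≤ : ∀ {b k} → (b ≡ true → D ≤ k) → ind b * D ≤ k
    ind*≤ {false} _ = z≤n
    ind*≤ {true}  D≤k = subst (_≤ _) (sym (+-identityʳ D)) (D≤k refl)

  anyFin-witness : ∀ {n} (p : Fin n → Bool) → anyFin p ≡ true → Σ (Fin n) λ i → p i ≡ true
  anyFin-witness {suc n} p e with p zero in p₀ | ∨-true {p zero} e
  ... | true  | _      = zero , p₀
  ... | false | inj₂ e′ with anyFin-witness (p ∘ suc) e′
  ...   | i , pᵢ = suc i , pᵢ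

  -- The first D elements of p in the order of Fin n (all of p if it has fewer).
  takeFirst : ∀ {n} → ℕ → (Fin n → Bool) → Fin n → Bool
  takeFirst zero    p _       = false
  takeFirst (suc D) p zero    = p zero
  takeFirst (suc D) p (suc i) = takeFirst (if p zero then D else suc D) (p ∘ suc) i

  takeFirst-⊆ : ∀ {n} D (p : Fin n → Bool) i → takeFirst D p i ≡ true → p i ≡ true
  takeFirst-⊆ (suc D) p zero    e = e
  takeFirst-⊆ (suc D) p (suc i) e = takeFirst-⊆ (if p zero then D else suc D) (p ∘ suc) i e

  count-takeFirst : ∀ {n} D (p : Fin n → Bool) → count (takeFirst D p) ≤ D
  count-takeFirst {zero}  D       p = z≤n
  count-takeFirst {suc n} zero    p = count-takeFirst {n} zero (p ∘ suc)
  count-takeFirst {suc n} (suc D) p with p zero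
  ... | true  = s≤s (count-takeFirst D (p ∘ suc))
  ... | false = count-takeFirst (suc D) (p ∘ suc)

  takeFirst-complete : ∀ {n} D (p : Fin n → Bool) → count (takeFirst D p) < D →
                       ∀ i → p i ≡ true → takeFirst D p i ≡ true
  takeFirst-complete (suc D) p _ zero e = e
  takeFirst-complete (suc D) p few (suc i) with p zero
  ... | true  = takeFirst-complete D (p ∘ suc) (≤-pred few) i
  ... | false = takeFirst-complete (suc D) (p ∘ suc) few i

  ∣∣≡count-lookup : ∀ {n} (U : Subset n) → ∣ U ∣ ≡ count (lookup U)
  ∣∣≡count-lookup []           = refl
  ∣∣≡count-lookup (true  ∷ U) = cong suc (∣∣≡count-lookup U)
  ∣∣≡count-lookup (false ∷ U) = ∣∣≡count-lookup U

  ∈⇒lookup : ∀ {n} {U : Subset n} {x} → x ∈ U → lookup U x ≡ true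
  ∈⇒lookup = []=⇒lookup

  lookup⇒∈ : ∀ {n} {U : Subset n} {x} → lookup U x ≡ true → x ∈ U
  lookup⇒∈ {U = U} {x} = lookup⇒[]= x U

  lookup⇒∉ : ∀ {n} {U : Subset n} {x} → lookup U x ≡ false → x ∉ U
  lookup⇒∉ e x∈U with trans (sym e) (∈⇒lookup x∈U)
  ... | ()

  symmetrise : ∀ {n} → (Fin n → Fin n → Bool) → EdgeSet n
  symmetrise q x y = q x y ∨ q y x

  _∪ₑ_ : ∀ {n} → EdgeSet n → EdgeSet n → EdgeSet n
  (F ∪ₑ H) x y = F x y ∨ H x y

  ∣∪ₑ∣≤ : ∀ {n} (F H : EdgeSet n) → ∣ F ∪ₑ H ∣ₑ ≤ ∣ F ∣ₑ + ∣ H ∣ₑ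
  ∣∪ₑ∣≤ {n} F H = begin
    sumFin (λ x → count (λ y → L x y ∧ (F x y ∨ H x y)))
      ≤⟨ sumFin-mono (λ x → count-≤-+ (λ y → L x y ∧ F x y) (λ y → L x y ∧ H x y) _ (λ y → split (L x y))) ⟩
    sumFin (λ x → count (λ y → L x y ∧ F x y) + count (λ y → L x y ∧ H x y))
      ≡⟨ sumFin-+ (λ x → count (λ y → L x y ∧ F x y)) (λ x → count (λ y → L x y ∧ H x y)) ⟩
    ∣ F ∣ₑ + ∣ H ∣ₑ ∎
    where
    open ≤-Reasoning
    L : Fin n → Fin n → Bool
    L x y = toℕ x <ᵇ toℕ y
    split : ∀ {a b} l → l ∧ (a ∨ b) ≡ true → l ∧ a ≡ true ⊎ l ∧ b ≡ true
    split {true}  true _ = inj₁ refl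
    split {false} true e = inj₂ e

  ∪ₑ-isEdgeSetOf : ∀ {n} {G : Graph n} {F H : EdgeSet n} →
                   IsEdgeSetOf G F → IsEdgeSetOf G H → IsEdgeSetOf G (F ∪ₑ H)
  ∪ₑ-isEdgeSetOf {F = F} {H} (F-sym , F⊆G) (H-sym , H⊆G) =
    (λ x y → cong₂ _∨_ (F-sym x y) (H-sym x y)) ,
    (λ x y e → [ F⊆G x y , H⊆G x y ]′ (∨-true {F x y} e))

  ind-<ᵇ-exclusive : ∀ m n → m ≢ n → ind (m <ᵇ n) + ind (n <ᵇ m) ≡ 1
  ind-<ᵇ-exclusive zero    zero    m≢n = ⊥-elim (m≢n refl)
  ind-<ᵇ-exclusive zero    (suc n) _   = refl
  ind-<ᵇ-exclusive (suc m) zero    _   = refl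
  ind-<ᵇ-exclusive (suc m) (suc n) m≢n = ind-<ᵇ-exclusive m n (m≢n ∘ cong suc)

  sumFin-count-flip : ∀ {n} (r : Fin n → Fin n → Bool) →
                      sumFin (λ x → count (λ y → r y x)) ≡ sumFin (λ x → count (r x))
  sumFin-count-flip r = begin
    sumFin (λ x → count (λ y → r y x))         ≡⟨ sumFin-cong (λ x → count≡sumFin-ind (λ y → r y x)) ⟩
    sumFin (λ x → sumFin (λ y → ind (r y x)))  ≡⟨ sumFin-comm (λ x y → ind (r y x)) ⟩
    sumFin (λ y → sumFin (λ x → ind (r y x)))  ≡⟨ sumFin-cong (λ y → count≡sumFin-ind (r y)) ⟨
    sumFin (λ y → count (r y))                 ∎
    where open ≡-Reasoning

  -- Each edge {x,y} of symmetrise q is counted once in ∣_∣ₑ (as the pair with the smaller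
  -- index first) and once on the right (at the unique end x with q x y).
  ∣symmetrise∣ₑ : ∀ {n} (q : Fin n → Fin n → Bool) → (∀ x y → q x y ≡ true → q y x ≡ false) →
                  ∣ symmetrise q ∣ₑ ≡ sumFin (degIn q)
  ∣symmetrise∣ₑ q asym = begin
    sumFin (λ x → count (λ y → L x y ∧ (q x y ∨ q y x)))
      ≡⟨ sumFin-cong (λ x → count-+ _ _ _ (λ y → disjoint (L x y) (asym x y))) ⟨
    sumFin (λ x → outward x + inward x)          ≡⟨ sumFin-+ outward inward ⟩
    sumFin outward + sumFin inward
      ≡⟨ cong (sumFin outward +_) (sumFin-count-flip (λ y x → L x y ∧ q y x)) ⟩
    sumFin outward + sumFin outward′             ≡⟨ sumFin-+ outward outward′ ⟨
    sumFin (λ x → outward x + outward′ x)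
      ≡⟨ sumFin-cong (λ x → count-+ _ _ _ (λ y → exactlyOneOrder (L x y) (L y x) (ordered x y))) ⟩
    sumFin (degIn q) ∎
    where
    open ≡-Reasoning
    L : Fin _ → Fin _ → Bool
    L x y = toℕ x <ᵇ toℕ y
    outward inward outward′ : Fin _ → ℕ
    outward  x = count (λ y → L x y ∧ q x y)
    inward   x = count (λ y → L x y ∧ q y x)
    outward′ x = count (λ y → L y x ∧ q x y)
    disjoint : ∀ l {a b} → (a ≡ true → b ≡ false) → ind (l ∧ a) + ind (l ∧ b) ≡ ind (l ∧ (a ∨ b))
    disjoint false         _     = refl
    disjoint true  {false} _     = refl
    disjoint true  {true}  a⇒¬b rewrite a⇒¬b refl = refl
    exactlyOneOrder : ∀ l₁ l₂ {b} → (b ≡ true → ind l₁ + ind l₂ ≡ 1) → ind (l₁ ∧ b) + ind (l₂ ∧ b) ≡ ind b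
    exactlyOneOrder l₁ l₂ {false} _ rewrite ∧-zeroʳ l₁ | ∧-zeroʳ l₂ = refl
    exactlyOneOrder l₁ l₂ {true}  one rewrite ∧-identityʳ l₁ | ∧-identityʳ l₂ = one refl
    ordered : ∀ x y → q x y ≡ true → ind (L x y) + ind (L y x) ≡ 1
    ordered x y e = ind-<ᵇ-exclusive (toℕ x) (toℕ y) λ x≡y → x≢y (toℕ-injective x≡y)
      where
      x≢y : x ≢ y
      x≢y refl with trans (sym e) (asym x x e)
      ... | ()

module Arithmetic where
  open import Data.Nat as ℕ using (ℕ; z≤n)
  import Data.Nat.Properties as ℕ
  open import Data.Nat.Divisibility using (∣1⇒≡1)
  open import Data.Integer as ℤ using (+_; -[1+_]; +0; +[1+_])
  import Data.Integer.Properties as ℤ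
  open import Data.Integer.DivMod using ([n/d]*d≤n)
  open import Data.Rational
  open import Data.Rational.Properties
  open import Data.Rational.Solver using (module +-*-Solver)
  open import Data.Product using (proj₂)
  open import Relation.Binary.PropositionalEquality
  open +-*-Solver using (solve; _:+_; _:*_; _:=_; con)

  ℕ→ℚ≡mkℚ : ∀ k → ℕ→ℚ k ≡ mkℚ (+ k) 0 (λ p → ∣1⇒≡1 (proj₂ p))
  ℕ→ℚ≡mkℚ k = normalize-coprime _

  ℕ→ℚ-+ : ∀ a b → ℕ→ℚ (a ℕ.+ b) ≡ ℕ→ℚ a + ℕ→ℚ b
  ℕ→ℚ-+ a b rewrite ℕ→ℚ≡mkℚ a | ℕ→ℚ≡mkℚ b = cong (_/ 1) (begin
    + (a ℕ.+ b)                    ≡⟨ ℤ.pos-+ a b ⟩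
    + a ℤ.+ + b                    ≡⟨ cong₂ ℤ._+_ (ℤ.*-identityʳ (+ a)) (ℤ.*-identityʳ (+ b)) ⟨
    + a ℤ.* + 1 ℤ.+ + b ℤ.* + 1    ∎)
    where open ≡-Reasoning

  ℕ→ℚ-* : ∀ a b → ℕ→ℚ (a ℕ.* b) ≡ ℕ→ℚ a * ℕ→ℚ b
  ℕ→ℚ-* a b rewrite ℕ→ℚ≡mkℚ a | ℕ→ℚ≡mkℚ b = cong (_/ 1) (ℤ.pos-* a b)

  ℕ→ℚ-mono-≤ : ∀ {a b} → a ℕ.≤ b → ℕ→ℚ a ≤ ℕ→ℚ b
  ℕ→ℚ-mono-≤ {a} {b} a≤b rewrite ℕ→ℚ≡mkℚ a | ℕ→ℚ≡mkℚ b =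
    *≤* (subst₂ ℤ._≤_ (sym (ℤ.*-identityʳ (+ a))) (sym (ℤ.*-identityʳ (+ b))) (ℤ.+≤+ a≤b))

  ℕ→ℚ-cancel-< : ∀ {a b} → ℕ→ℚ a < ℕ→ℚ b → a ℕ.< b
  ℕ→ℚ-cancel-< {a} {b} a<b rewrite ℕ→ℚ≡mkℚ a | ℕ→ℚ≡mkℚ b with a<b
  ... | *<* a*1<b*1 = ℤ.drop‿+<+ (subst₂ ℤ._<_ (ℤ.*-identityʳ (+ a)) (ℤ.*-identityʳ (+ b)) a*1<b*1)

  ℕ→ℚ-nonNeg : ∀ k → NonNegative (ℕ→ℚ k)
  ℕ→ℚ-nonNeg k = nonNegative (ℕ→ℚ-mono-≤ {0} {k} z≤n)

  ⌈⌉≡-[-↥/↧] : ∀ q → ⌈ q ⌉ ≡ ℤ.- ((ℤ.- ↥ q) ℤ./ ↧ q)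
  ⌈⌉≡-[-↥/↧] (mkℚ -[1+ _ ] _ _) = refl
  ⌈⌉≡-[-↥/↧] (mkℚ +0       _ _) = refl
  ⌈⌉≡-[-↥/↧] (mkℚ +[1+ _ ] _ _) = refl

  ↥≤⌈⌉*↧ : ∀ q → ↥ q ℤ.≤ ⌈ q ⌉ ℤ.* ↧ q
  ↥≤⌈⌉*↧ q@(mkℚ _ _ _) rewrite ⌈⌉≡-[-↥/↧] q =
    subst₂ ℤ._≤_ (ℤ.neg-involutive (↥ q)) (ℤ.neg-distribˡ-* ((ℤ.- ↥ q) ℤ./ ↧ q) (↧ q))
      (ℤ.neg-mono-≤ ([n/d]*d≤n (ℤ.- ↥ q) (↧ q)))

  +∣⌈⌉∣≡⌈⌉ : ∀ {q} → 0ℚ ≤ q → + ℤ.∣ ⌈ q ⌉ ∣ ≡ ⌈ q ⌉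
  +∣⌈⌉∣≡⌈⌉ {q@(mkℚ n _ _)} (*≤* 0≤n*1) = ℤ.0≤i⇒+∣i∣≡i
    (ℤ.*-cancelʳ-≤-pos (+ 0) ⌈ q ⌉ (↧ q) (ℤ.≤-trans (subst (+ 0 ℤ.≤_) (ℤ.*-identityʳ n) 0≤n*1) (↥≤⌈⌉*↧ q)))

  ≤ℕ→ℚ∣⌈⌉∣ : ∀ {q} → 0ℚ ≤ q → q ≤ ℕ→ℚ ℤ.∣ ⌈ q ⌉ ∣
  ≤ℕ→ℚ∣⌈⌉∣ {q@(mkℚ n _ _)} 0≤q rewrite ℕ→ℚ≡mkℚ ℤ.∣ ⌈ q ⌉ ∣ =
    *≤* (subst₂ ℤ._≤_ (sym (ℤ.*-identityʳ n)) (cong (ℤ._* ↧ q) (sym (+∣⌈⌉∣≡⌈⌉ 0≤q))) (↥≤⌈⌉*↧ q))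

  ≤∣⌈⌉∣⇒+≤⌈⌉ : ∀ {q k} → 0ℚ ≤ q → k ℕ.≤ ℤ.∣ ⌈ q ⌉ ∣ → + k ℤ.≤ ⌈ q ⌉
  ≤∣⌈⌉∣⇒+≤⌈⌉ 0≤q k≤∣⌈q⌉∣ = subst (+ _ ℤ.≤_) (+∣⌈⌉∣≡⌈⌉ 0≤q) (ℤ.+≤+ k≤∣⌈q⌉∣)

  quotient-< : ∀ {c z D s a} → 0ℚ ≤ c → c ≤ ℕ→ℚ D → s ℕ.* D ℕ.≤ a → ℕ→ℚ a < z * c → ℕ→ℚ s < z
  quotient-< {c} {z} {D} {s} {a} 0≤c c≤D sD≤a a<zc = *-cancelʳ-<-nonNeg c {{nonNegative 0≤c}} (begin-strict
    ℕ→ℚ s * c          ≤⟨ *-monoˡ-≤-nonNeg (ℕ→ℚ s) {{ℕ→ℚ-nonNeg s}} c≤D ⟩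
    ℕ→ℚ s * ℕ→ℚ D      ≡⟨ ℕ→ℚ-* s D ⟨
    ℕ→ℚ (s ℕ.* D)      ≤⟨ ℕ→ℚ-mono-≤ sD≤a ⟩
    ℕ→ℚ a              <⟨ a<zc ⟩
    z * c              ∎)
    where open ≤-Reasoning

  seventh⇒7*< : ∀ {ε s u} → ε ≤ 1ℚ → ℕ→ℚ s < (ε ÷ₙ 7) * ℕ→ℚ u → 7 ℕ.* s ℕ.< u
  seventh⇒7*< {ε} {s} {u} ε≤1 s-small = ℕ→ℚ-cancel-< (begin-strict
    ℕ→ℚ (7 ℕ.* s)                ≡⟨ ℕ→ℚ-* 7 s ⟩
    ℕ→ℚ 7 * ℕ→ℚ s                <⟨ *-monoʳ-<-pos (ℕ→ℚ 7) s-small ⟩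
    ℕ→ℚ 7 * ((ε ÷ₙ 7) * ℕ→ℚ u)
      ≡⟨ solve 2 (λ ε m → con (ℕ→ℚ 7) :* (ε :* con (+ 1 / 7) :* m) := ε :* m) refl ε (ℕ→ℚ u) ⟩
    ε * ℕ→ℚ u                    ≤⟨ *-monoʳ-≤-nonNeg (ℕ→ℚ u) {{ℕ→ℚ-nonNeg u}} ε≤1 ⟩
    1ℚ * ℕ→ℚ u                   ≡⟨ *-identityˡ (ℕ→ℚ u) ⟩
    ℕ→ℚ u                        ∎)
    where open ≤-Reasoning

  two-sevenths<third : ∀ {ε c x y m m′} → 0ℚ ≤ ε → 0ℚ ≤ c → ℕ→ℚ 6 * m ≤ ℕ→ℚ 7 * m′ →
                       x < (ε ÷ₙ 7) * c * m → y < (ε ÷ₙ 7) * c * m → x + y < (ε ÷ₙ 3) * c * m′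
  two-sevenths<third {ε} {c} {x} {y} {m} {m′} 0≤ε 0≤c 6m≤7m′ x-small y-small = begin-strict
    x + y                                  <⟨ +-mono-< x-small y-small ⟩
    (ε ÷ₙ 7) * c * m + (ε ÷ₙ 7) * c * m
      ≡⟨ solve 3 (λ ε c m → ε :* con (+ 1 / 7) :* c :* m :+ ε :* con (+ 1 / 7) :* c :* m
                            := ε :* con (+ 1 / 21) :* c :* (con (ℕ→ℚ 6) :* m)) refl ε c m ⟩
    κ * (ℕ→ℚ 6 * m)
      ≤⟨ *-monoˡ-≤-nonNeg κ {{κ-nonNeg}} 6m≤7m′ ⟩
    κ * (ℕ→ℚ 7 * m′)
      ≡⟨ solve 3 (λ ε c m → ε :* con (+ 1 / 21) :* c :* (con (ℕ→ℚ 7) :* m)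
                            := ε :* con (+ 1 / 3) :* c :* m) refl ε c m′ ⟩
    (ε ÷ₙ 3) * c * m′
      ∎
    where
    open ≤-Reasoning
    κ : ℚ
    κ = ε * (+ 1 / 21) * c
    κ-nonNeg : NonNegative κ
    κ-nonNeg = nonNeg*nonNeg⇒nonNeg (ε * (+ 1 / 21)) {{nonNeg*nonNeg⇒nonNeg ε {{nonNegative 0≤ε}} (+ 1 / 21)}}
                                    c {{nonNegative 0≤c}}

  module BothKeptSetsSmall {ε d : ℚ} {D u u′ s t a b : ℕ}
    (0≤ε : 0ℚ ≤ ε) (ε≤1 : ε ≤ 1ℚ) (0≤d : 0ℚ ≤ d) (d≤D : d ≤ ℕ→ℚ D)
    (u′+s≡u : u′ ℕ.+ s ≡ u) (sD≤a : s ℕ.* D ℕ.≤ a) (tD≤b : t ℕ.* D ℕ.≤ b)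
    (a-small : ℕ→ℚ a < (ε ÷ₙ 7) * d * ℕ→ℚ u) (b-small : ℕ→ℚ b < (ε ÷ₙ 7) * d * ℕ→ℚ u) where

    private
      fewer-than-seventh : ∀ {k c} → k ℕ.* D ℕ.≤ c → ℕ→ℚ c < (ε ÷ₙ 7) * d * ℕ→ℚ u →
                           ℕ→ℚ k < (ε ÷ₙ 7) * 1ℚ * ℕ→ℚ u
      fewer-than-seventh {k} kD≤c c-small = quotient-< {D = D} {s = k} 0≤d d≤D kD≤c (subst (_ <_)
        (solve 3 (λ ε d m → ε :* con (+ 1 / 7) :* d :* m := ε :* con (+ 1 / 7) :* con 1ℚ :* m :* d)
                 refl ε d (ℕ→ℚ u))
        c-small)

      s-small : ℕ→ℚ s < (ε ÷ₙ 7) * 1ℚ * ℕ→ℚ u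
      s-small = fewer-than-seventh {s} sD≤a a-small

      6s<u′ : 6 ℕ.* s ℕ.< u′
      6s<u′ = ℕ.+-cancelˡ-< s (6 ℕ.* s) u′
        (subst (7 ℕ.* s ℕ.<_) (trans (sym u′+s≡u) (ℕ.+-comm u′ s))
          (seventh⇒7*< {s = s} ε≤1 (subst (_ <_) (cong (_* ℕ→ℚ u) (*-identityʳ (ε ÷ₙ 7))) s-small)))

      6u≤7u′ : ℕ→ℚ 6 * ℕ→ℚ u ≤ ℕ→ℚ 7 * ℕ→ℚ u′
      6u≤7u′ = subst₂ _≤_ (ℕ→ℚ-* 6 u) (ℕ→ℚ-* 7 u′) (ℕ→ℚ-mono-≤ (begin
        6 ℕ.* u                 ≡⟨ cong (6 ℕ.*_) u′+s≡u ⟨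
        6 ℕ.* (u′ ℕ.+ s)        ≡⟨ ℕ.*-distribˡ-+ 6 u′ s ⟩
        6 ℕ.* u′ ℕ.+ 6 ℕ.* s    ≤⟨ ℕ.+-monoʳ-≤ (6 ℕ.* u′) (ℕ.<⇒≤ 6s<u′) ⟩
        6 ℕ.* u′ ℕ.+ u′         ≡⟨ ℕ.+-comm (6 ℕ.* u′) u′ ⟩
        7 ℕ.* u′                ∎))
        where open ℕ.≤-Reasoning

    u′-positive : 0 ℕ.< u′
    u′-positive = ℕ.≤-<-trans z≤n 6s<u′

    a+b-small : ℕ→ℚ (a ℕ.+ b) < (ε ÷ₙ 3) * d * ℕ→ℚ u′
    a+b-small = subst (_< _) (sym (ℕ→ℚ-+ a b)) (two-sevenths<third 0≤ε 0≤d 6u≤7u′ a-small b-small)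

    s+t-small : ℕ→ℚ (s ℕ.+ t) < (ε ÷ₙ 3) * ℕ→ℚ u′
    s+t-small = subst₂ _<_ (sym (ℕ→ℚ-+ s t)) (cong (_* ℕ→ℚ u′) (*-identityʳ (ε ÷ₙ 3)))
      (two-sevenths<third 0≤ε (nonNegative⁻¹ 1ℚ) 6u≤7u′ s-small (fewer-than-seventh {t} tD≤b b-small))

module GreedySelection {n} (G : Graph n) (U : Subset n) (col : Colouring n) (D : ℕ) where
  open Counting
  open import Data.Bool using (Bool; true; false; _∧_; _∨_; not)
  open import Data.Bool.Properties using (∨-comm)
  open import Data.Nat using (_+_; _*_; _≤_; _≤ᵇ_)
  open import Data.Nat.Properties using (≤-trans; m≤m+n)
  open import Data.Vec using (lookup; tabulate)
  open import Data.Vec.Properties using (lookup∘tabulate)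
  open import Data.Product using (_×_; _,_; proj₁; proj₂)
  open import Data.Sum using (_⊎_; inj₁; inj₂)
  open import Data.Empty using (⊥-elim)
  open import Function using (flip)
  open import Relation.Binary.PropositionalEquality

  inU : Fin n → Bool
  inU = lookup U

  record CrossingEdge (c : Bool) (u w : Fin n) : Set where
    field
      source∈U : inU u ≡ true
      target∉U : inU w ≡ false
      edge     : adj G u w ≡ true
      colour   : col u w ≡ c
  open CrossingEdge

  OrientedCrossing : (Fin n → Fin n → Bool) → Bool → Set
  OrientedCrossing q c = ∀ u w → q u w ≡ true → CrossingEdge c u w

  oriented-asym : ∀ {q c} → OrientedCrossing q c → ∀ u w → q u w ≡ true → q w u ≡ false
  oriented-asym {q} crossing u w e with q w u in e′
  ... | false = refl
  ... | true  = ⊥-elim (true≢false (source∈U (crossing u w e)) (target∉U (crossing w u e′)))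

  oriented-monochromatic : ∀ {q c} → OrientedCrossing q c → MonochromaticCrossing G U col c (symmetrise q)
  oriented-monochromatic {q} {c} crossing = (symmetric , ⊆G) , from-U , from-outside
    where
    symmetric : ∀ x y → symmetrise q x y ≡ symmetrise q y x
    symmetric x y = ∨-comm (q x y) (q y x)
    ⊆G : ∀ x y → symmetrise q x y ≡ true → adj G x y ≡ true
    ⊆G x y e with ∨-true {q x y} e
    ... | inj₁ e′ = edge (crossing x y e′)
    ... | inj₂ e′ = trans (Graph.sym G x y) (edge (crossing y x e′))
    from-U : ∀ x y → symmetrise q x y ≡ true → x ∈ U → y ∉ U × col x y ≡ c
    from-U x y e x∈U with ∨-true {q x y} e
    ... | inj₁ e′ = lookup⇒∉ (target∉U (crossing x y e′)) , colour (crossing x y e′)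
    ... | inj₂ e′ = ⊥-elim (true≢false (∈⇒lookup x∈U) (target∉U (crossing y x e′)))
    from-outside : ∀ x y → symmetrise q x y ≡ true → x ∉ U → y ∈ U
    from-outside x y e x∉U with ∨-true {q x y} e
    ... | inj₁ e′ = ⊥-elim (x∉U (lookup⇒∈ (source∈U (crossing x y e′))))
    ... | inj₂ e′ = lookup⇒∈ (source∈U (crossing y x e′))

  redNbr : Fin n → Fin n → Bool
  redNbr u w = inU u ∧ not (inU w) ∧ adj G u w ∧ col u w

  blueNbr : Fin n → Fin n → Bool
  blueNbr w u = not (inU w) ∧ inU u ∧ adj G u w ∧ not (col u w)

  redKept blueKept : Fin n → Fin n → Bool
  redKept  u = takeFirst D (redNbr u)
  blueKept w = takeFirst D (blueNbr w)

  redKept-crossing : OrientedCrossing redKept red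
  redKept-crossing u w e with ∧-true {inU u} (takeFirst-⊆ D (redNbr u) w e)
  ... | u∈U , e₁ with ∧-true {not (inU w)} e₁
  ... | w∉U , e₂ with ∧-true {adj G u w} e₂
  ... | uw , red-uw = record { source∈U = u∈U ; target∉U = not-true w∉U ; edge = uw ; colour = red-uw }

  blueKept-crossing : OrientedCrossing (flip blueKept) blue
  blueKept-crossing u w e with ∧-true {not (inU w)} (takeFirst-⊆ D (blueNbr w) u e)
  ... | w∉U , e₁ with ∧-true {inU u} e₁
  ... | u∈U , e₂ with ∧-true {adj G u w} e₂
  ... | uw , blue-uw =
    record { source∈U = u∈U ; target∉U = not-true w∉U ; edge = uw ; colour = not-true blue-uw }

  Fr Fb F′ : EdgeSet n
  Fr = symmetrise redKept
  Fb = symmetrise (flip blueKept)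
  F′ = Fr ∪ₑ Fb

  Fr-crossing : MonochromaticCrossing G U col red Fr
  Fr-crossing = oriented-monochromatic redKept-crossing

  Fb-crossing : MonochromaticCrossing G U col blue Fb
  Fb-crossing = oriented-monochromatic blueKept-crossing

  F′-isEdgeSetOf : IsEdgeSetOf G F′
  F′-isEdgeSetOf = ∪ₑ-isEdgeSetOf {G = G} {Fr} {Fb} (proj₁ Fr-crossing) (proj₁ Fb-crossing)

  Fr-degree : ∀ v → v ∈ U → degIn Fr v ≤ D
  Fr-degree v v∈U = ≤-trans (count-mono kept-by-v) (count-takeFirst D (redNbr v))
    where
    kept-by-v : ∀ w → Fr v w ≡ true → redKept v w ≡ true
    kept-by-v w e with ∨-true {redKept v w} e
    ... | inj₁ e′ = e′
    ... | inj₂ e′ = ⊥-elim (true≢false (∈⇒lookup v∈U) (target∉U (redKept-crossing w v e′)))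

  Fb-degree : ∀ v → v ∉ U → degIn Fb v ≤ D
  Fb-degree v v∉U = ≤-trans (count-mono kept-by-v) (count-takeFirst D (blueNbr v))
    where
    kept-by-v : ∀ w → Fb v w ≡ true → blueKept v w ≡ true
    kept-by-v w e with ∨-true {blueKept w v} e
    ... | inj₁ e′ = ⊥-elim (v∉U (lookup⇒∈ (source∈U (blueKept-crossing v w e′))))
    ... | inj₂ e′ = e′

  fullRed fullBlue : Fin n → Bool
  fullRed  u = inU u ∧ (D ≤ᵇ degIn redKept u)
  fullBlue w = not (inU w) ∧ (D ≤ᵇ degIn blueKept w)

  U′ : Subset n
  U′ = tabulate λ u → inU u ∧ not (D ≤ᵇ degIn redKept u)

  fullRed*D≤∣Fr∣ : count fullRed * D ≤ ∣ Fr ∣ₑ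
  fullRed*D≤∣Fr∣ = subst (count fullRed * D ≤_)
    (sym (∣symmetrise∣ₑ redKept (oriented-asym redKept-crossing)))
    (count*≤sumFin fullRed (degIn redKept) λ u e → ≤ᵇ≡true⇒≤ (proj₂ (∧-true {inU u} e)))

  fullBlue*D≤∣Fb∣ : count fullBlue * D ≤ ∣ Fb ∣ₑ
  fullBlue*D≤∣Fb∣ = subst (count fullBlue * D ≤_)
    (sym (trans (∣symmetrise∣ₑ (flip blueKept) (oriented-asym blueKept-crossing)) (sumFin-count-flip blueKept)))
    (count*≤sumFin fullBlue (degIn blueKept) λ w e → ≤ᵇ≡true⇒≤ (proj₂ (∧-true {not (inU w)} e)))

  ∣U′∣+fullRed≡∣U∣ : ∣ U′ ∣ + count fullRed ≡ ∣ U ∣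
  ∣U′∣+fullRed≡∣U∣ = begin
    ∣ U′ ∣ + count fullRed           ≡⟨ cong (_+ count fullRed) (∣∣≡count-lookup U′) ⟩
    count (lookup U′) + count fullRed ≡⟨ count-+ (lookup U′) fullRed inU (λ u → split (lookup∘tabulate _ u)) ⟩
    count inU                        ≡⟨ ∣∣≡count-lookup U ⟨
    ∣ U ∣                            ∎
    where
    open ≡-Reasoning
    split : ∀ {a b c} → a ≡ b ∧ not c → ind a + ind (b ∧ c) ≡ ind b
    split {b = false}             refl = refl
    split {b = true}  {c = false} refl = refl
    split {b = true}  {c = true}  refl = refl

  ∣U′∣≤∣U∣ : ∣ U′ ∣ ≤ ∣ U ∣
  ∣U′∣≤∣U∣ = subst (∣ U′ ∣ ≤_) ∣U′∣+fullRed≡∣U∣ (m≤m+n ∣ U′ ∣ (count fullRed))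

  U′⊆U : ∀ {w} → lookup U′ w ≡ true → inU w ≡ true
  U′⊆U {w} w∈U′ = proj₁ (∧-true {inU w} (trans (sym (lookup∘tabulate _ w)) w∈U′))

  nonFull-keeps-red : ∀ {w v} → lookup U′ w ≡ true → redNbr w v ≡ true → F′ w v ≡ true
  nonFull-keeps-red {w} {v} w∈U′ e = ∨-introˡ (∨-introˡ
    (takeFirst-complete D (redNbr w) (≤ᵇ≡false⇒> (not-true nonFull)) v e))
    where
    nonFull : not (D ≤ᵇ degIn redKept w) ≡ true
    nonFull = proj₂ (∧-true {inU w} (trans (sym (lookup∘tabulate _ w)) w∈U′))

  nonFull-keeps-blue : ∀ {w v} → (D ≤ᵇ degIn blueKept v) ≡ false → blueNbr v w ≡ true → F′ w v ≡ true
  nonFull-keeps-blue {w} {v} nonFull e = ∨-introʳ {Fr w v} (∨-introˡ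
    (takeFirst-complete D (blueNbr v) (≤ᵇ≡false⇒> nonFull) w e))

  inside-neighbour-full : ∀ {v} → inU v ≡ true → lookup U′ v ≡ false → fullRed v ≡ true
  inside-neighbour-full {v} v∈U v∉U′ = full v∈U (trans (sym (lookup∘tabulate _ v)) v∉U′)
    where
    full : ∀ {a c} → a ≡ true → a ∧ not c ≡ false → a ∧ c ≡ true
    full {c = true} refl _ = refl

  outside-neighbour-full : ∀ {v w} → inU v ≡ false → lookup U′ w ≡ true → adj G w v ≡ true →
                           F′ w v ≡ false → fullBlue v ≡ true
  outside-neighbour-full {v} {w} v∉U w∈U′ wv not-kept with col w v in wv-colour | D ≤ᵇ degIn blueKept v in full?
  ... | true  | _     = ⊥-elim (true≢false (nonFull-keeps-red w∈U′ red-edge) not-kept)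
    where
    red-edge : redNbr w v ≡ true
    red-edge = ∧-intro (U′⊆U w∈U′) (∧-intro (cong not v∉U) (∧-intro wv wv-colour))
  -- The with-abstraction has already replaced D ≤ᵇ degIn blueKept v by true in the goal.
  ... | false | true  = ∧-intro (cong not v∉U) refl
  ... | false | false = ⊥-elim (true≢false (nonFull-keeps-blue full? blue-edge) not-kept)
    where
    blue-edge : blueNbr v w ≡ true
    blue-edge = ∧-intro (cong not v∉U) (∧-intro (U′⊆U w∈U′) (∧-intro wv (cong not wv-colour)))

  ∣N∣≤full : ∣N∣ G F′ U′ ≤ count fullRed + count fullBlue
  ∣N∣≤full = count-≤-+ fullRed fullBlue _ neighbour-full
    where
    neighbour-full : ∀ v → not (lookup U′ v) ∧ anyFin (λ w → lookup U′ w ∧ adj G w v ∧ not (F′ w v)) ≡ true →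
                     fullRed v ≡ true ⊎ fullBlue v ≡ true
    neighbour-full v e with ∧-true {not (lookup U′ v)} e | true-or-false (inU v)
    ... | v∉U′ , _  | inj₁ v∈U = inj₁ (inside-neighbour-full v∈U (not-true v∉U′))
    ... | _    , ∃w | inj₂ v∉U with anyFin-witness (λ w → lookup U′ w ∧ adj G w v ∧ not (F′ w v)) ∃w
    ...   | w , e′ with ∧-true {lookup U′ w} e′
    ...     | w∈U′ , e″ with ∧-true {adj G w v} e″
    ...       | wv , not-kept = inj₂ (outside-neighbour-full v∉U w∈U′ wv (not-true not-kept))

open import Data.Integer using (+_)
open import Data.Rational using (ℚ; _*_; _≤_; 0ℚ; 1ℚ; ceiling)
open import Data.Rational using (_<_; ↧ₙ_)
open import Data.Integer using () renaming (_≤_ to _≤ℤ_)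
open import Data.Product using (Σ; _×_; _,_)
open import Data.Sum using (_⊎_; inj₁; inj₂)
import Data.Sum as Sum
import Data.Nat as ℕ
import Data.Nat.Properties as ℕ
import Data.Integer as ℤ
open import Data.Rational.Properties
  using (_≤?_; ≰⇒>; ≤-trans; <⇒≤; <-irrefl; nonNegative⁻¹; normalize-nonNeg; module ≤-Reasoning)
open import Data.Empty using (⊥; ⊥-elim)
open import Relation.Nullary using (Dec; yes; no)
open import Relation.Binary.PropositionalEquality using (refl)
open Counting using (∣∪ₑ∣≤)
open Arithmetic using (ℕ→ℚ-mono-≤; ≤ℕ→ℚ∣⌈⌉∣; ≤∣⌈⌉∣⇒+≤⌈⌉; module BothKeptSetsSmall)

avgDeg-nonNeg : ∀ {n} .{{_ : NonZero n}} (G : Graph n) → 0ℚ ≤ avgDeg G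
avgDeg-nonNeg {n} G = nonNegative⁻¹ (avgDeg G) {{normalize-nonNeg (2 ℕ.* numEdges G) n}}

SizeBound-mono : ∀ {u′ u n} ε → u′ ℕ.≤ u → SizeBound u n ε → SizeBound u′ n ε
SizeBound-mono ε u′≤u = ℕ.≤-trans (ℕ.^-monoˡ-≤ (↧ₙ ε) u′≤u)

module _ {n} .{{_ : NonZero n}} (G : Graph n) (U : Subset n) (col : Colouring n) where
  open GreedySelection G U col ℤ.∣ ⌈ avgDeg G ⌉ ∣

  kept-sets-not-both-small : RobustSublinearExpander G → ∀ {ε} → 0ℚ ≤ ε → ε ≤ 1ℚ → SizeBound ∣ U ∣ n ε →
                             ℕ→ℚ ∣ Fr ∣ₑ < (ε ÷ₙ 7) * avgDeg G * ℕ→ℚ ∣ U ∣ →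
                             ℕ→ℚ ∣ Fb ∣ₑ < (ε ÷ₙ 7) * avgDeg G * ℕ→ℚ ∣ U ∣ → ⊥
  kept-sets-not-both-small expander {ε} 0≤ε ε≤1 sizeBound red-small blue-small = <-irrefl refl (begin-strict
    (ε ÷ₙ 3) * ℕ→ℚ ∣ U′ ∣
      ≤⟨ expander ε 0≤ε ε≤1 U′ u′-positive (SizeBound-mono ε ∣U′∣≤∣U∣ sizeBound) F′ F′-isEdgeSetOf F′-small ⟩
    ℕ→ℚ (∣N∣ G F′ U′)
      ≤⟨ ℕ→ℚ-mono-≤ ∣N∣≤full ⟩
    ℕ→ℚ (count fullRed ℕ.+ count fullBlue)
      <⟨ s+t-small ⟩
    (ε ÷ₙ 3) * ℕ→ℚ ∣ U′ ∣
      ∎)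
    where
    open ≤-Reasoning
    open BothKeptSetsSmall {D = ℤ.∣ ⌈ avgDeg G ⌉ ∣} {∣ U ∣} {∣ U′ ∣} {count fullRed} {count fullBlue}
                           {∣ Fr ∣ₑ} {∣ Fb ∣ₑ}
      0≤ε ε≤1 (avgDeg-nonNeg G) (≤ℕ→ℚ∣⌈⌉∣ (avgDeg-nonNeg G)) ∣U′∣+fullRed≡∣U∣
      fullRed*D≤∣Fr∣ fullBlue*D≤∣Fb∣ red-small blue-small
    F′-small : ℕ→ℚ ∣ F′ ∣ₑ ≤ (ε ÷ₙ 3) * avgDeg G * ℕ→ℚ ∣ U′ ∣
    F′-small = ≤-trans (ℕ→ℚ-mono-≤ (∣∪ₑ∣≤ Fr Fb)) (<⇒≤ a+b-small)

  some-kept-set-large : RobustSublinearExpander G → ∀ {ε} → 0ℚ ≤ ε → ε ≤ 1ℚ → SizeBound ∣ U ∣ n ε →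
                        (ε ÷ₙ 7) * avgDeg G * ℕ→ℚ ∣ U ∣ ≤ ℕ→ℚ ∣ Fr ∣ₑ ⊎
                        (ε ÷ₙ 7) * avgDeg G * ℕ→ℚ ∣ U ∣ ≤ ℕ→ℚ ∣ Fb ∣ₑ
  some-kept-set-large expander {ε} 0≤ε ε≤1 sizeBound = choose (bound ≤? ℕ→ℚ ∣ Fr ∣ₑ) (bound ≤? ℕ→ℚ ∣ Fb ∣ₑ)
    where
    bound : ℚ
    bound = (ε ÷ₙ 7) * avgDeg G * ℕ→ℚ ∣ U ∣
    choose : Dec (bound ≤ ℕ→ℚ ∣ Fr ∣ₑ) → Dec (bound ≤ ℕ→ℚ ∣ Fb ∣ₑ) →
             bound ≤ ℕ→ℚ ∣ Fr ∣ₑ ⊎ bound ≤ ℕ→ℚ ∣ Fb ∣ₑ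
    choose (yes large)    _             = inj₁ large
    choose (no _)         (yes large)   = inj₂ large
    choose (no red-small) (no blue-small) =
      ⊥-elim (kept-sets-not-both-small expander 0≤ε ε≤1 sizeBound (≰⇒> red-small) (≰⇒> blue-small))

lemma4p1 : ∀ {n} .{{_ : NonZero n}} (G : Graph n) → RobustSublinearExpander G →
    ∀ (ε : ℚ) → 0ℚ ≤ ε → ε ≤ 1ℚ →
    ∀ (U : Subset n) → SizeBound ∣ U ∣ n ε →
    ∀ (col : Colouring n) →
    (Σ (EdgeSet n) λ Fr → MonochromaticCrossing G U col red Fr ×
       (ε ÷ₙ 7) * avgDeg G * ℕ→ℚ ∣ U ∣ ≤ ℕ→ℚ ∣ Fr ∣ₑ ×
       (∀ (v : Fin n) → v ∈ U → + (degIn Fr v) ≤ℤ ⌈ avgDeg G ⌉))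
    ⊎
    (Σ (EdgeSet n) λ Fb → MonochromaticCrossing G U col blue Fb ×
       (ε ÷ₙ 7) * avgDeg G * ℕ→ℚ ∣ U ∣ ≤ ℕ→ℚ ∣ Fb ∣ₑ ×
       (∀ (v : Fin n) → v ∉ U → + (degIn Fb v) ≤ℤ ⌈ avgDeg G ⌉))
lemma4p1 G expander ε 0≤ε ε≤1 U sizeBound col =
  Sum.map (λ large → Fr , Fr-crossing , large , λ v v∈U → ≤⌈d⌉ (Fr-degree v v∈U))
          (λ large → Fb , Fb-crossing , large , λ v v∉U → ≤⌈d⌉ (Fb-degree v v∉U))
          (some-kept-set-large G U col expander 0≤ε ε≤1 sizeBound)
  where
  open GreedySelection G U col ℤ.∣ ⌈ avgDeg G ⌉ ∣
  ≤⌈d⌉ : ∀ {k} → k ℕ.≤ ℤ.∣ ⌈ avgDeg G ⌉ ∣ → + k ≤ℤ ⌈ avgDeg G ⌉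
  ≤⌈d⌉ = ≤∣⌈⌉∣⇒+≤⌈⌉ (avgDeg-nonNeg G)
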